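{- Let $G=(V,E)$ be an undirected graph and $S\subseteq V$. Every minimal $S$-strong region $R\subseteq V$ induces a connected subgraph of $G$.
   Context: For $S\subseteq V$, $\mathcal{P}_S$ is obtained by (Rule 1) putting every node of $S$ and every neighbor of a node of $S$ into $\mathcal{P}_S$, and (Rule 2) repeatedly: if $v\in\mathcal{P}_S$ and all neighbors of $v$ except exactly one neighbor $w$ are in $\mathcal{P}_S$, insert $w$. For $R\subseteq V$, $nbr(R)=\{v\in V\setminus R: v$ adjacent to some $u\in R\}$. $R$ is an $S$-strong region if $R\not\subseteq\mathcal{P}_{S\cup nbr(R)}$, and an $S$-weak region otherwise. $R$ is a minimal $S$-strong region if it is $S$-strong and $R\setminus\{r\}$ is $S$-weak for every $r\in R$. -}

module Defs where

open import Data.Nat using (ℕ)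
open import Data.Fin using (Fin)
open import Data.Fin.Subset using (Subset; _∈_; _∉_; _-_)
open import Data.Product using (Σ; _×_)
open import Data.Sum using (_⊎_)
open import Relation.Binary.PropositionalEquality using (_≡_; _≢_)
open import Relation.Nullary using (¬_; Dec)

record Graph : Set₁ where
  field
    n      : ℕ
    Adj    : Fin n → Fin n → Set
    adj?   : ∀ u v → Dec (Adj u v)
    sym    : ∀ {u v} → Adj u v → Adj v u
    irrefl : ∀ {u} → ¬ Adj u u

module _ (G : Graph) where
  open Graph G

  V : Set
  V = Fin n

  -- Membership in 𝒫_T for a generating vertex set T (given as a predicate):
  -- the least set closed under Rule 1 and Rule 2.
  data InP (T : V → Set) : V → Set where
    rule1-self : ∀ {v} → T v → InP T v
    rule1-nbr  : ∀ {u v} → T u → Adj u v → InP T v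
    rule2      : ∀ {v w} → InP T v → Adj v w →
                 (∀ x → Adj v x → x ≢ w → InP T x) → InP T w

  InNbr : Subset n → V → Set
  InNbr R v = v ∉ R × Σ V (λ u → u ∈ R × Adj u v)

  SUnionNbr : Subset n → Subset n → V → Set
  SUnionNbr S R v = v ∈ S ⊎ InNbr R v

  Weak : Subset n → Subset n → Set
  Weak S R = ∀ r → r ∈ R → InP (SUnionNbr S R) r

  Strong : Subset n → Subset n → Set
  Strong S R = ¬ Weak S R

  MinimalStrong : Subset n → Subset n → Set
  MinimalStrong S R = Strong S R × (∀ r → r ∈ R → Weak S (R - r))

  -- a path from u to v all of whose vertices lie in R (u ∈ R assumed separately)
  data PathIn (R : Subset n) : V → V → Set where
    here : ∀ {u} → PathIn R u u
    step : ∀ {u w v} → Adj u w → w ∈ R → PathIn R w v → PathIn R u v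

  InducesConnected : Subset n → Set
  InducesConnected R = ∀ u v → u ∈ R → v ∈ R → PathIn R u v

-- If R fell apart into two pieces, pick u and v in different components and let
-- C be the union of components containing u (resp. not containing u). Since C is
-- separated from v (resp. u) inside R, a derivation of x ∈ 𝒫 for R ∖ {v} with
-- x ∈ C can be replayed for R: generators that differ between the two closures
-- are never adjacent to C. Minimality thus covers all of R, so R is weak.
module Submission where

open import Defs
open import Data.Fin.Properties using (any?)
open import Data.Fin.Subset using (Subset; _∈_; _∉_; _-_; _∪_; ⁅_⁆; _⊂_; _⊃_)
open import Data.Fin.Subset.Properties
  using (_∈?_; x∈⁅x⁆; x∈⁅y⁆⇒x≡y; p⊆p∪q; q⊆p∪q; x∈p∪q⁻; x∈p∧x≢y⇒x∈p-y)
open import Data.Fin.Subset.Induction using (⊃-wellFounded)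
open import Data.Product using (∃; _×_; _,_; proj₁)
open import Data.Sum using (inj₁; inj₂)
open import Data.Empty using (⊥-elim)
open import Induction.WellFounded using (Acc; acc)
open import Relation.Nullary using (¬_; Dec; yes; no)
open import Relation.Nullary.Decidable using (_×-dec_; ¬?; decidable-stable; map′)
open import Relation.Binary.PropositionalEquality using (_≢_; sym; subst)

module _ (G : Graph) where
  open Graph G renaming (sym to adj-sym)

  path-snoc : ∀ {R u v w} → PathIn G R u v → Adj v w → w ∈ R → PathIn G R u w
  path-snoc here            e w∈R = step e w∈R here
  path-snoc (step e′ x∈R p) e w∈R = step e′ x∈R (path-snoc p e w∈R)

  AdjClosed : Subset n → (V G → Set) → Set
  AdjClosed R C = ∀ {x y} → C x → Adj x y → y ∈ R → C y

  path-closed : ∀ {R C u v} → AdjClosed R C → C u → PathIn G R u v → C v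
  path-closed closed Cu here           = Cu
  path-closed closed Cu (step e w∈R p) = path-closed closed (closed Cu e w∈R) p

  reachable-closed : ∀ {R u} → AdjClosed R (PathIn G R u)
  reachable-closed = path-snoc

  unreachable-closed : ∀ {R u} → AdjClosed R (λ y → y ∈ R × ¬ PathIn G R u y)
  unreachable-closed (x∈R , u↛x) e y∈R =
    y∈R , λ u→y → u↛x (path-snoc u→y (adj-sym e) x∈R)

  record Component (R : Subset n) (u : V G) : Set where
    field
      members   : Subset n
      root      : u ∈ members
      reachable : ∀ {x} → x ∈ members → PathIn G R u x
      closed    : AdjClosed R (_∈ members)

  component : ∀ R u → Component R u
  component R u = grow ⁅ u ⁆ (⊃-wellFounded ⁅ u ⁆) (x∈⁅x⁆ u) singleton-reachable
    where
    singleton-reachable : ∀ {x} → x ∈ ⁅ u ⁆ → PathIn G R u x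
    singleton-reachable x∈⁅u⁆ = subst (PathIn G R u) (sym (x∈⁅y⁆⇒x≡y u x∈⁅u⁆)) here

    Exit : Subset n → Set
    Exit A = ∃ λ x → ∃ λ y → x ∈ A × Adj x y × y ∈ R × y ∉ A

    exit? : ∀ A → Dec (Exit A)
    exit? A = any? λ x → any? λ y →
      (x ∈? A) ×-dec adj? x y ×-dec (y ∈? R) ×-dec ¬? (y ∈? A)

    grow : ∀ A → Acc _⊃_ A → u ∈ A → (∀ {x} → x ∈ A → PathIn G R u x) → Component R u
    grow A _ u∈A reach with exit? A
    ... | no no-exit = record
      { members = A ; root = u∈A ; reachable = reach
      ; closed = λ {x} {y} x∈A e y∈R →
          decidable-stable (y ∈? A) (λ y∉A → no-exit (x , y , x∈A , e , y∈R , y∉A)) }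
    grow A (acc larger) u∈A reach | yes (x , y , x∈A , e , y∈R , y∉A) =
      grow (A ∪ ⁅ y ⁆) (larger A⊂A∪y) (p⊆p∪q ⁅ y ⁆ u∈A) reach′
      where
      A⊂A∪y : A ⊂ A ∪ ⁅ y ⁆
      A⊂A∪y = p⊆p∪q ⁅ y ⁆ , y , q⊆p∪q A ⁅ y ⁆ (x∈⁅x⁆ y) , y∉A

      reach′ : ∀ {z} → z ∈ A ∪ ⁅ y ⁆ → PathIn G R u z
      reach′ {z} z∈ with x∈p∪q⁻ A ⁅ y ⁆ z∈
      ... | inj₁ z∈A = reach z∈A
      ... | inj₂ z∈y = subst (PathIn G R u) (sym (x∈⁅y⁆⇒x≡y y z∈y))
                             (path-snoc (reach x∈A) e y∈R)

  reachable? : ∀ R u v → Dec (PathIn G R u v)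
  reachable? R u v =
    map′ reachable (path-closed closed root) (v ∈? members)
    where open Component (component R u)

  path-end-∈ : ∀ {R u v} → u ∈ R → PathIn G R u v → v ∈ R
  path-end-∈ = path-closed (λ _ _ y∈R → y∈R)

  -- The two generating sets S ∪ nbr(R ∖ {r}) and S ∪ nbr(R) differ only at r and
  -- outside R; C is not adjacent to r, and its neighbours outside R lie in nbr(R).
  Weak-remove⇒InP : ∀ {S R r C} → Weak G S (R - r) →
                    (∀ {x} → C x → x ∈ R) → ¬ C r → AdjClosed R C →
                    ∀ {w} → C w → InP G (SUnionNbr G S R) w
  Weak-remove⇒InP {S} {R} {r} {C} weak C⊆R r∉C closed Cw =
    replay Cw (weak _ (C⊆R-r Cw))
    where
    C⊆R-r : ∀ {x} → C x → x ∈ R - r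
    C⊆R-r Cx = x∈p∧x≢y⇒x∈p-y (C⊆R Cx) λ x≡r → r∉C (subst C x≡r Cx)

    replay : ∀ {w} → C w → InP G (SUnionNbr G S (R - r)) w → InP G (SUnionNbr G S R) w
    replay Cw (rule1-self (inj₁ w∈S))          = rule1-self (inj₁ w∈S)
    replay Cw (rule1-self (inj₂ (w∉R-r , _)))  = ⊥-elim (w∉R-r (C⊆R-r Cw))
    replay Cw (rule1-nbr (inj₁ u∈S) e)         = rule1-nbr (inj₁ u∈S) e
    replay {w} Cw (rule1-nbr {u} (inj₂ (u∉R-r , _)) e) with u ∈? R
    ... | yes u∈R = ⊥-elim (u∉R-r (C⊆R-r (closed Cw (adj-sym e) u∈R)))
    ... | no u∉R  = rule1-nbr (inj₂ (u∉R , w , C⊆R Cw , adj-sym e)) e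
    replay {w} Cw (rule2 {v} v∈P e others) with v ∈? R
    ... | no v∉R  = rule1-nbr (inj₂ (v∉R , w , C⊆R Cw , adj-sym e)) e
    ... | yes v∈R = rule2 (replay Cv v∈P) e others′
      where
      Cv : C v
      Cv = closed Cw (adj-sym e) v∈R

      others′ : ∀ x → Adj v x → x ≢ w → InP G (SUnionNbr G S R) x
      others′ x e′ x≢w with x ∈? R
      ... | yes x∈R = replay (closed Cv e′ x∈R) (others x e′ x≢w)
      ... | no x∉R  = rule1-self (inj₂ (x∉R , v , v∈R , e′))

lemma5 : (G : Graph) (S R : Subset (Graph.n G)) →
    MinimalStrong G S R → InducesConnected G R
lemma5 G S R (strong , minimal) u v u∈R v∈R with reachable? G R u v
... | yes u→v = u→v
... | no u↛v  = ⊥-elim (strong weak)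
  where
  weak : Weak G S R
  weak x x∈R with reachable? G R u x
  ... | yes u→x = Weak-remove⇒InP G (minimal v v∈R)
                    (path-end-∈ G u∈R) u↛v (reachable-closed G) u→x
  ... | no u↛x  = Weak-remove⇒InP G (minimal u u∈R)
                    proj₁ (λ (_ , u↛u) → u↛u here) (unreachable-closed G) (x∈R , u↛x)
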